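{- For all non-negative integers $n$, \[T_{n+2}^2=p_n^2+\sum_{k=1}^n\sum_{l=1}^k\{4(T_l+T_{l-1})+\delta_{l,1}-2\delta_{l,2}-2c_{l-5}\}T_{k-l+2}^2p_{n-k}^2.\]
   Context: Tribonacci numbers: $T_n=T_{n-1}+T_{n-2}+T_{n-3}+\delta_{n,2}$ for all integers $n$, with $T_n=0$ for $n<2$. Narayana's cows sequence: $c_n=c_{n-1}+c_{n-3}+\delta_{n,0}$, $c_n=0$ for $n<0$. Padovan numbers (in this offset): $p_n=p_{n-2}+p_{n-3}+\delta_{n,0}$, $p_n=0$ for $n<0$. $\delta_{i,j}$ is $1$ if $i=j$ and $0$ otherwise. Empty sums are zero. -}

module Defs where

open import Data.Nat using (ℕ; zero; suc; _+_)
open import Data.Integer using (ℤ; +_; -[1+_]) renaming (_+_ to _+ℤ_)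

T : ℕ → ℕ
T zero = 0
T (suc zero) = 0
T (suc (suc zero)) = 1
T (suc (suc (suc n))) = T (suc (suc n)) + T (suc n) + T n

c : ℕ → ℕ
c zero = 1
c (suc zero) = 1
c (suc (suc zero)) = 1
c (suc (suc (suc n))) = c (suc (suc n)) + c n

cℤ : ℤ → ℕ
cℤ (+ n) = c n
cℤ -[1+ _ ] = 0

p : ℕ → ℕ
p zero = 1
p (suc zero) = 0
p (suc (suc zero)) = 1
p (suc (suc (suc n))) = p (suc n) + p n

δ : ℕ → ℕ → ℤ
δ zero zero = + 1
δ zero (suc _) = + 0
δ (suc _) zero = + 0
δ (suc i) (suc j) = δ i j

Σ1 : ℕ → (ℕ → ℤ) → ℤ
Σ1 zero f = + 0
Σ1 (suc n) f = Σ1 n f +ℤ f (suc n)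

-- In ℤ[[x]] the identity reads a = q + (f a) q, with a, q, f the generating functions of T²ₙ₊₂,
-- pₙ² and of the bracketed weight. All three are rational: squares of a solution of a third-order
-- recurrence satisfy the sixth-order recurrence whose roots are the pairwise products of the old
-- roots, and the weight is eventually a tribonacci-type plus a Narayana-type sequence. Multiplying
-- through by the product of the three denominators leaves an identity between integer polynomials,
-- checked by computation; the denominators have constant term 1, so they can be cancelled.
module Submission where

open import Defs
open import Data.Nat using (ℕ; _∸_)
open import Data.Integer using (ℤ; +_; _+_; _-_; _*_)
open import Relation.Binary.PropositionalEquality using (_≡_)

open import Algebra.Bundles using (CommutativeMonoid)
open import Data.Integer using (-_; -[1+_])
import Data.Integer.Properties as ℤ
open import Data.Integer.Tactic.RingSolver using (solve-∀; solve)
open import Data.Fin using (#_)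
open import Data.Product using (_,_)
open import Data.List using (List; []; _∷_; map)
open import Data.Nat using (zero; suc; _<_; z≤n; s≤s)
import Data.Nat as ℕ
import Data.Nat.Properties as ℕₚ
open import Data.Nat.Induction using (<-rec)
open import Function using (_∘_)
open import Level using (0ℓ)
open import Relation.Binary.PropositionalEquality
  using (_≗_; refl; sym; trans; cong; cong₂; module ≡-Reasoning)

-- Formal power series

Series : Set
Series = ℕ → ℤ

0ₛ 1ₛ : Series
0ₛ _ = + 0
1ₛ zero = + 1
1ₛ (suc _) = + 0

infixl 6 _+ₛ_ _-ₛ_
infixl 7 _*ₛ_

_+ₛ_ _-ₛ_ : Series → Series → Series
(f +ₛ g) n = f n + g n
(f -ₛ g) n = f n - g n

_*ₛ_ : Series → Series → Series
(f *ₛ g) zero = f 0 * g 0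
(f *ₛ g) (suc n) = f 0 * g (suc n) + (f ∘ suc *ₛ g) n

shift : Series → Series
shift f zero = + 0
shift f (suc n) = f n

*ₛ-cong : ∀ {f f′ g g′} → f ≗ f′ → g ≗ g′ → f *ₛ g ≗ f′ *ₛ g′
*ₛ-cong f≗f′ g≗g′ zero = cong₂ _*_ (f≗f′ 0) (g≗g′ 0)
*ₛ-cong f≗f′ g≗g′ (suc n) =
  cong₂ _+_ (cong₂ _*_ (f≗f′ 0) (g≗g′ (suc n))) (*ₛ-cong (f≗f′ ∘ suc) g≗g′ n)

*ₛ-unfold : ∀ f g → f *ₛ g ≗ (λ n → f 0 * g n) +ₛ shift (f ∘ suc *ₛ g)
*ₛ-unfold f g zero = sym (ℤ.+-identityʳ (f 0 * g 0))
*ₛ-unfold f g (suc n) = refl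

*ₛ-sucʳ : ∀ f g n → (f *ₛ g) (suc n) ≡ (f *ₛ g ∘ suc) n + f (suc n) * g 0
*ₛ-sucʳ f g zero = refl
*ₛ-sucʳ f g (suc n) =
  trans (cong (_+_ (f 0 * g (suc (suc n)))) (*ₛ-sucʳ (f ∘ suc) g n))
        (sym (ℤ.+-assoc (f 0 * g (suc (suc n))) ((f ∘ suc *ₛ g ∘ suc) n) (f (suc (suc n)) * g 0)))

*ₛ-comm : ∀ f g → f *ₛ g ≗ g *ₛ f
*ₛ-comm f g zero = ℤ.*-comm (f 0) (g 0)
*ₛ-comm f g (suc n) = begin
  f 0 * g (suc n) + (f ∘ suc *ₛ g) n   ≡⟨ cong₂ _+_ (ℤ.*-comm (f 0) (g (suc n))) (*ₛ-comm (f ∘ suc) g n) ⟩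
  g (suc n) * f 0 + (g *ₛ f ∘ suc) n   ≡⟨ ℤ.+-comm (g (suc n) * f 0) ((g *ₛ f ∘ suc) n) ⟩
  (g *ₛ f ∘ suc) n + g (suc n) * f 0   ≡⟨ *ₛ-sucʳ g f n ⟨
  (g *ₛ f) (suc n)                     ∎
  where open ≡-Reasoning

*ₛ-zeroˡ : ∀ g → 0ₛ *ₛ g ≗ 0ₛ
*ₛ-zeroˡ g zero = refl
*ₛ-zeroˡ g (suc n) = trans (ℤ.+-identityˡ ((0ₛ *ₛ g) n)) (*ₛ-zeroˡ g n)

*ₛ-identityˡ : ∀ g → 1ₛ *ₛ g ≗ g
*ₛ-identityˡ g zero = ℤ.*-identityˡ (g 0)
*ₛ-identityˡ g (suc n) = begin
  + 1 * g (suc n) + (0ₛ *ₛ g) n   ≡⟨ cong₂ _+_ (ℤ.*-identityˡ (g (suc n))) (*ₛ-zeroˡ g n) ⟩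
  g (suc n) + + 0                 ≡⟨ ℤ.+-identityʳ (g (suc n)) ⟩
  g (suc n)                       ∎
  where open ≡-Reasoning

*ₛ-identityʳ : ∀ g → g *ₛ 1ₛ ≗ g
*ₛ-identityʳ g n = trans (*ₛ-comm g 1ₛ n) (*ₛ-identityˡ g n)

*ₛ-distribʳ-+ₛ : ∀ f g h → (f +ₛ g) *ₛ h ≗ f *ₛ h +ₛ g *ₛ h
*ₛ-distribʳ-+ₛ f g h zero = ℤ.*-distribʳ-+ (h 0) (f 0) (g 0)
*ₛ-distribʳ-+ₛ f g h (suc n) =
  trans (cong₂ _+_ (ℤ.*-distribʳ-+ (h (suc n)) (f 0) (g 0)) (*ₛ-distribʳ-+ₛ (f ∘ suc) (g ∘ suc) h n))
        (interchange (f 0 * h (suc n)) (g 0 * h (suc n)) ((f ∘ suc *ₛ h) n) ((g ∘ suc *ₛ h) n))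
  where
  interchange : ∀ a b c d → (a + b) + (c + d) ≡ (a + c) + (b + d)
  interchange = solve-∀

*ₛ-distribʳ-−ₛ : ∀ f g h → (f -ₛ g) *ₛ h ≗ f *ₛ h -ₛ g *ₛ h
*ₛ-distribʳ-−ₛ f g h zero = distrib (f 0) (g 0) (h 0)
  where
  distrib : ∀ a b x → (a - b) * x ≡ a * x - b * x
  distrib = solve-∀
*ₛ-distribʳ-−ₛ f g h (suc n) =
  trans (cong (_+_ ((f 0 - g 0) * h (suc n))) (*ₛ-distribʳ-−ₛ (f ∘ suc) (g ∘ suc) h n))
        (distrib (f 0) (g 0) (h (suc n)) _ _)
  where
  distrib : ∀ a b x c d → (a - b) * x + (c - d) ≡ (a * x + c) - (b * x + d)
  distrib = solve-∀

*ₛ-distribˡ-+ₛ : ∀ f g h → h *ₛ (f +ₛ g) ≗ h *ₛ f +ₛ h *ₛ g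
*ₛ-distribˡ-+ₛ f g h n = begin
  (h *ₛ (f +ₛ g)) n         ≡⟨ *ₛ-comm h (f +ₛ g) n ⟩
  ((f +ₛ g) *ₛ h) n         ≡⟨ *ₛ-distribʳ-+ₛ f g h n ⟩
  (f *ₛ h +ₛ g *ₛ h) n      ≡⟨ cong₂ _+_ (*ₛ-comm f h n) (*ₛ-comm g h n) ⟩
  (h *ₛ f +ₛ h *ₛ g) n      ∎
  where open ≡-Reasoning

*ₛ-scaleˡ : ∀ x f h → (λ n → x * f n) *ₛ h ≗ λ n → x * (f *ₛ h) n
*ₛ-scaleˡ x f h zero = ℤ.*-assoc x (f 0) (h 0)
*ₛ-scaleˡ x f h (suc n) =
  trans (cong₂ _+_ (ℤ.*-assoc x (f 0) (h (suc n))) (*ₛ-scaleˡ x (f ∘ suc) h n))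
        (sym (ℤ.*-distribˡ-+ x (f 0 * h (suc n)) ((f ∘ suc *ₛ h) n)))

*ₛ-shiftˡ : ∀ f h → shift f *ₛ h ≗ shift (f *ₛ h)
*ₛ-shiftˡ f h zero = refl
*ₛ-shiftˡ f h (suc n) = ℤ.+-identityˡ ((f *ₛ h) n)

-- f = f₀ + x·f′, and for f′ the claim is needed one index lower.
*ₛ-assoc : ∀ f g h → (f *ₛ g) *ₛ h ≗ f *ₛ (g *ₛ h)
*ₛ-assoc f g h n = begin
  ((f *ₛ g) *ₛ h) n
    ≡⟨ *ₛ-cong (*ₛ-unfold f g) (λ _ → refl) n ⟩
  (((λ m → f 0 * g m) +ₛ shift (f ∘ suc *ₛ g)) *ₛ h) n
    ≡⟨ *ₛ-distribʳ-+ₛ (λ m → f 0 * g m) (shift (f ∘ suc *ₛ g)) h n ⟩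
  ((λ m → f 0 * g m) *ₛ h) n + (shift (f ∘ suc *ₛ g) *ₛ h) n
    ≡⟨ cong₂ _+_ (*ₛ-scaleˡ (f 0) g h n) (*ₛ-shiftˡ (f ∘ suc *ₛ g) h n) ⟩
  f 0 * (g *ₛ h) n + shift ((f ∘ suc *ₛ g) *ₛ h) n
    ≡⟨ cong (_+_ (f 0 * (g *ₛ h) n)) (tail n) ⟩
  f 0 * (g *ₛ h) n + shift (f ∘ suc *ₛ (g *ₛ h)) n
    ≡⟨ *ₛ-unfold f (g *ₛ h) n ⟨
  (f *ₛ (g *ₛ h)) n ∎
  where
  open ≡-Reasoning
  tail : ∀ n → shift ((f ∘ suc *ₛ g) *ₛ h) n ≡ shift (f ∘ suc *ₛ (g *ₛ h)) n
  tail zero = refl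
  tail (suc n) = *ₛ-assoc (f ∘ suc) g h n

*ₛ-commutativeMonoid : CommutativeMonoid 0ℓ 0ℓ
*ₛ-commutativeMonoid = record
  { Carrier = Series
  ; _≈_ = _≗_
  ; _∙_ = _*ₛ_
  ; ε = 1ₛ
  ; isCommutativeMonoid = record
    { isMonoid = record
      { isSemigroup = record
        { isMagma = record
          { isEquivalence = record
            { refl = λ _ → refl
            ; sym = λ e n → sym (e n)
            ; trans = λ e e′ n → trans (e n) (e′ n)
            }
          ; ∙-cong = *ₛ-cong
          }
        ; assoc = *ₛ-assoc
        }
      ; identity = *ₛ-identityˡ , *ₛ-identityʳ
      }
    ; comm = *ₛ-comm
    }
  }

*ₛ-lowestTerm : ∀ e h n → (∀ {m} → m < n → e m ≡ + 0) → (e *ₛ h) n ≡ e n * h 0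
*ₛ-lowestTerm e h zero _ = refl
*ₛ-lowestTerm e h (suc n) e<n≡0 = begin
  e 0 * h (suc n) + (e ∘ suc *ₛ h) n   ≡⟨ cong₂ _+_ (cong (_* h (suc n)) (e<n≡0 (s≤s z≤n)))
                                                    (*ₛ-lowestTerm (e ∘ suc) h n (e<n≡0 ∘ s≤s)) ⟩
  + 0 * h (suc n) + e (suc n) * h 0    ≡⟨ ℤ.+-identityˡ (e (suc n) * h 0) ⟩
  e (suc n) * h 0                      ∎
  where open ≡-Reasoning

d*ₛe≗0⇒e≗0 : ∀ d e → d 0 ≡ + 1 → d *ₛ e ≗ 0ₛ → e ≗ 0ₛ
d*ₛe≗0⇒e≗0 d e d₀≡1 de≗0 = <-rec _ vanish
  where
  open ≡-Reasoning
  vanish : ∀ n → (∀ {m} → m < n → e m ≡ + 0) → e n ≡ + 0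
  vanish n e<n≡0 = begin
    e n          ≡⟨ ℤ.*-identityʳ (e n) ⟨
    e n * + 1    ≡⟨ cong (e n *_) d₀≡1 ⟨
    e n * d 0    ≡⟨ *ₛ-lowestTerm e d n e<n≡0 ⟨
    (e *ₛ d) n   ≡⟨ *ₛ-comm e d n ⟩
    (d *ₛ e) n   ≡⟨ de≗0 n ⟩
    + 0          ∎

*ₛ-cancelˡ : ∀ d {f g} → d 0 ≡ + 1 → d *ₛ f ≗ d *ₛ g → f ≗ g
*ₛ-cancelˡ d {f} {g} d₀≡1 df≗dg n =
  ℤ.i-j≡0⇒i≡j (f n) (g n) (d*ₛe≗0⇒e≗0 d (f -ₛ g) d₀≡1 d[f-g]≗0 n)
  where
  d[f-g]≗0 : d *ₛ (f -ₛ g) ≗ 0ₛ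
  d[f-g]≗0 m = begin
    (d *ₛ (f -ₛ g)) m        ≡⟨ *ₛ-comm d (f -ₛ g) m ⟩
    ((f -ₛ g) *ₛ d) m        ≡⟨ *ₛ-distribʳ-−ₛ f g d m ⟩
    (f *ₛ d) m - (g *ₛ d) m  ≡⟨ cong₂ _-_ (*ₛ-comm f d m) (*ₛ-comm g d m) ⟩
    (d *ₛ f) m - (d *ₛ g) m  ≡⟨ cong (_- (d *ₛ g) m) (df≗dg m) ⟩
    (d *ₛ g) m - (d *ₛ g) m  ≡⟨ ℤ.+-inverseʳ ((d *ₛ g) m) ⟩
    + 0                      ∎
    where open ≡-Reasoning

+ₛ-cong : ∀ {f f′ g g′} → f ≗ f′ → g ≗ g′ → f +ₛ g ≗ f′ +ₛ g′
+ₛ-cong f≗f′ g≗g′ n = cong₂ _+_ (f≗f′ n) (g≗g′ n)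

*ₛ-fraction-equation : ∀ {A Q F a q f Nₐ N_q N_f : Series} →
  ((A *ₛ Q) *ₛ F) 0 ≡ + 1 →
  A *ₛ a ≗ Nₐ → Q *ₛ q ≗ N_q → F *ₛ f ≗ N_f →
  (Q *ₛ F) *ₛ Nₐ ≗ (A *ₛ F) *ₛ N_q +ₛ (N_f *ₛ Nₐ) *ₛ N_q →
  a ≗ q +ₛ (f *ₛ a) *ₛ q
*ₛ-fraction-equation {A} {Q} {F} {a} {q} {f} {Nₐ} {N_q} {N_f} D₀≡1 Aa≗Nₐ Qq≗N_q Ff≗N_f numerators =
  *ₛ-cancelˡ D D₀≡1 (begin
    D *ₛ a                                  ≈⟨ regroup-a ⟩
    (Q *ₛ F) *ₛ (A *ₛ a)                    ≈⟨ *ₛ-cong (λ _ → refl) Aa≗Nₐ ⟩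
    (Q *ₛ F) *ₛ Nₐ                          ≈⟨ numerators ⟩
    (A *ₛ F) *ₛ N_q +ₛ (N_f *ₛ Nₐ) *ₛ N_q   ≈⟨ +ₛ-cong (*ₛ-cong (λ _ → refl) Qq≗N_q)
                                                        (*ₛ-cong (*ₛ-cong Ff≗N_f Aa≗Nₐ) Qq≗N_q) ⟨
    (A *ₛ F) *ₛ (Q *ₛ q) +ₛ ((F *ₛ f) *ₛ (A *ₛ a)) *ₛ (Q *ₛ q)
                                            ≈⟨ +ₛ-cong regroup-q regroup-faq ⟩
    D *ₛ q +ₛ D *ₛ ((f *ₛ a) *ₛ q)          ≈⟨ *ₛ-distribˡ-+ₛ q ((f *ₛ a) *ₛ q) D ⟨
    D *ₛ (q +ₛ (f *ₛ a) *ₛ q)               ∎)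
  where
  open CommutativeMonoid *ₛ-commutativeMonoid using (setoid)
  open import Relation.Binary.Reasoning.Setoid setoid
  open import Algebra.Solver.CommutativeMonoid *ₛ-commutativeMonoid using (Expr; prove; var; _⊕_)
  open import Data.Vec using (Vec; _∷_; [])

  D : Series
  D = (A *ₛ Q) *ₛ F

  ρ : Vec Series 6
  ρ = A ∷ Q ∷ F ∷ a ∷ q ∷ f ∷ []

  A′ Q′ F′ a′ q′ f′ : Expr 6
  A′ = var (# 0)
  Q′ = var (# 1)
  F′ = var (# 2)
  a′ = var (# 3)
  q′ = var (# 4)
  f′ = var (# 5)

  regroup-a : D *ₛ a ≗ (Q *ₛ F) *ₛ (A *ₛ a)
  regroup-a = prove 6 (((A′ ⊕ Q′) ⊕ F′) ⊕ a′) ((Q′ ⊕ F′) ⊕ (A′ ⊕ a′)) ρ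

  regroup-q : (A *ₛ F) *ₛ (Q *ₛ q) ≗ D *ₛ q
  regroup-q = prove 6 ((A′ ⊕ F′) ⊕ (Q′ ⊕ q′)) (((A′ ⊕ Q′) ⊕ F′) ⊕ q′) ρ

  regroup-faq : ((F *ₛ f) *ₛ (A *ₛ a)) *ₛ (Q *ₛ q) ≗ D *ₛ ((f *ₛ a) *ₛ q)
  regroup-faq =
    prove 6 (((F′ ⊕ f′) ⊕ (A′ ⊕ a′)) ⊕ (Q′ ⊕ q′)) (((A′ ⊕ Q′) ⊕ F′) ⊕ ((f′ ⊕ a′) ⊕ q′)) ρ

Σ1-unfoldˡ : ∀ n F → Σ1 (suc n) F ≡ F 1 + Σ1 n (F ∘ suc)
Σ1-unfoldˡ zero F = trans (ℤ.+-identityˡ (F 1)) (sym (ℤ.+-identityʳ (F 1)))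
Σ1-unfoldˡ (suc n) F =
  trans (cong (_+ F (2 ℕ.+ n)) (Σ1-unfoldˡ n F)) (ℤ.+-assoc (F 1) (Σ1 n (F ∘ suc)) (F (2 ℕ.+ n)))

Σ1-cong : ∀ n {F G} → (∀ k → F (suc k) ≡ G (suc k)) → Σ1 n F ≡ Σ1 n G
Σ1-cong zero F≡G = refl
Σ1-cong (suc n) F≡G = cong₂ _+_ (Σ1-cong n F≡G) (F≡G n)

Σ1-*ʳ : ∀ n F x → Σ1 n F * x ≡ Σ1 n (λ k → F k * x)
Σ1-*ʳ zero F x = ℤ.*-zeroˡ x
Σ1-*ʳ (suc n) F x =
  trans (ℤ.*-distribʳ-+ x (Σ1 n F) (F (suc n))) (cong (_+ F (suc n) * x) (Σ1-*ʳ n F x))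

*ₛ-as-Σ1 : ∀ f g n → (f *ₛ g) n ≡ f 0 * g n + Σ1 n (λ k → f k * g (n ∸ k))
*ₛ-as-Σ1 f g zero = sym (ℤ.+-identityʳ (f 0 * g 0))
*ₛ-as-Σ1 f g (suc n) =
  cong (_+_ (f 0 * g (suc n)))
       (trans (*ₛ-as-Σ1 (f ∘ suc) g n) (sym (Σ1-unfoldˡ n (λ k → f k * g (suc n ∸ k)))))

f₀≡0⇒*ₛ-as-Σ1 : ∀ f g → f 0 ≡ + 0 → ∀ n → (f *ₛ g) n ≡ Σ1 n (λ k → f k * g (n ∸ k))
f₀≡0⇒*ₛ-as-Σ1 f g f₀≡0 n =
  trans (*ₛ-as-Σ1 f g n) (trans (cong (λ x → x * g n + sum) f₀≡0) (ℤ.+-identityˡ sum))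
  where
  sum : ℤ
  sum = Σ1 n (λ k → f k * g (n ∸ k))

f₀≡0⇒*ₛ-as-double-Σ1 : ∀ f g h → f 0 ≡ + 0 → ∀ n →
  ((f *ₛ g) *ₛ h) n ≡ Σ1 n (λ k → Σ1 k (λ l → f l * g (k ∸ l) * h (n ∸ k)))
f₀≡0⇒*ₛ-as-double-Σ1 f g h f₀≡0 n = begin
  ((f *ₛ g) *ₛ h) n
    ≡⟨ f₀≡0⇒*ₛ-as-Σ1 (f *ₛ g) h (cong (_* g 0) f₀≡0) n ⟩
  Σ1 n (λ k → (f *ₛ g) k * h (n ∸ k))
    ≡⟨ Σ1-cong n inner ⟩
  Σ1 n (λ k → Σ1 k (λ l → f l * g (k ∸ l) * h (n ∸ k))) ∎
  where
  open ≡-Reasoning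
  inner : ∀ k →
    (f *ₛ g) (suc k) * h (n ∸ suc k) ≡ Σ1 (suc k) (λ l → f l * g (suc k ∸ l) * h (n ∸ suc k))
  inner k = trans (cong (_* h (n ∸ suc k)) (f₀≡0⇒*ₛ-as-Σ1 f g f₀≡0 (suc k)))
                  (Σ1-*ʳ (suc k) (λ l → f l * g (suc k ∸ l)) (h (n ∸ suc k)))

-- Polynomials as coefficient lists

toSeries : List ℤ → Series
toSeries [] _ = + 0
toSeries (x ∷ xs) zero = x
toSeries (x ∷ xs) (suc n) = toSeries xs n

infixl 6 _+ₚ_
infixl 7 _*ₚ_

_+ₚ_ : List ℤ → List ℤ → List ℤ
[] +ₚ ys = ys
(x ∷ xs) +ₚ [] = x ∷ xs
(x ∷ xs) +ₚ (y ∷ ys) = x + y ∷ xs +ₚ ys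

_*ₚ_ : List ℤ → List ℤ → List ℤ
[] *ₚ ys = []
(x ∷ xs) *ₚ ys = map (x *_) ys +ₚ (+ 0 ∷ xs *ₚ ys)

toSeries-+ₚ : ∀ xs ys → toSeries (xs +ₚ ys) ≗ toSeries xs +ₛ toSeries ys
toSeries-+ₚ [] ys n = sym (ℤ.+-identityˡ (toSeries ys n))
toSeries-+ₚ (x ∷ xs) [] n = sym (ℤ.+-identityʳ (toSeries (x ∷ xs) n))
toSeries-+ₚ (x ∷ xs) (y ∷ ys) zero = refl
toSeries-+ₚ (x ∷ xs) (y ∷ ys) (suc n) = toSeries-+ₚ xs ys n

toSeries-map-* : ∀ x ys → toSeries (map (x *_) ys) ≗ λ n → x * toSeries ys n
toSeries-map-* x [] n = sym (ℤ.*-zeroʳ x)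
toSeries-map-* x (y ∷ ys) zero = refl
toSeries-map-* x (y ∷ ys) (suc n) = toSeries-map-* x ys n

toSeries-*ₚ : ∀ xs ys → toSeries (xs *ₚ ys) ≗ toSeries xs *ₛ toSeries ys
toSeries-*ₚ [] ys n = sym (*ₛ-zeroˡ (toSeries ys) n)
toSeries-*ₚ (x ∷ xs) ys n = begin
  toSeries (map (x *_) ys +ₚ (+ 0 ∷ xs *ₚ ys)) n
    ≡⟨ toSeries-+ₚ (map (x *_) ys) (+ 0 ∷ xs *ₚ ys) n ⟩
  toSeries (map (x *_) ys) n + toSeries (+ 0 ∷ xs *ₚ ys) n
    ≡⟨ cong₂ _+_ (toSeries-map-* x ys n) (shifted n) ⟩
  x * toSeries ys n + shift (toSeries xs *ₛ toSeries ys) n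
    ≡⟨ *ₛ-unfold (toSeries (x ∷ xs)) (toSeries ys) n ⟨
  (toSeries (x ∷ xs) *ₛ toSeries ys) n ∎
  where
  open ≡-Reasoning
  shifted : ∀ n → toSeries (+ 0 ∷ xs *ₚ ys) n ≡ shift (toSeries xs *ₛ toSeries ys) n
  shifted zero = refl
  shifted (suc n) = toSeries-*ₚ xs ys n

consNormal : ℤ → List ℤ → List ℤ
consNormal (+ zero) [] = []
consNormal x ys = x ∷ ys

normalise : List ℤ → List ℤ
normalise [] = []
normalise (x ∷ xs) = consNormal x (normalise xs)

toSeries-consNormal : ∀ x ys → toSeries (consNormal x ys) ≗ toSeries (x ∷ ys)
toSeries-consNormal (+ zero) [] zero = refl
toSeries-consNormal (+ zero) [] (suc n) = refl
toSeries-consNormal (+ zero) (y ∷ ys) n = refl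
toSeries-consNormal (+ suc _) ys n = refl
toSeries-consNormal -[1+ _ ] ys n = refl

toSeries-normalise : ∀ xs → toSeries (normalise xs) ≗ toSeries xs
toSeries-normalise [] n = refl
toSeries-normalise (x ∷ xs) n = trans (toSeries-consNormal x (normalise xs) n) (cons-cong n)
  where
  cons-cong : toSeries (x ∷ normalise xs) ≗ toSeries (x ∷ xs)
  cons-cong zero = refl
  cons-cong (suc n) = toSeries-normalise xs n

normalise⇒toSeries-≗ : ∀ xs ys → normalise xs ≡ normalise ys → toSeries xs ≗ toSeries ys
normalise⇒toSeries-≗ xs ys eq n =
  trans (sym (toSeries-normalise xs n)) (trans (cong (λ zs → toSeries zs n) eq) (toSeries-normalise ys n))

-- The product toSeries xs *ₛ s, by recursion on xs so that at an index deg xs + n it unfolds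
-- definitionally into the bare linear recurrence Σᵢ xsᵢ s(deg xs + n − i).
infix 8 _◃_

_◃_ : List ℤ → Series → Series
([] ◃ s) _ = + 0
((x ∷ []) ◃ s) n = x * s n
((x ∷ y ∷ xs) ◃ s) zero = x * s 0
((x ∷ y ∷ xs) ◃ s) (suc n) = x * s (suc n) + ((y ∷ xs) ◃ s) n

toSeries-*ₛ : ∀ xs s → toSeries xs *ₛ s ≗ xs ◃ s
toSeries-*ₛ [] s n = *ₛ-zeroˡ s n
toSeries-*ₛ (x ∷ []) s zero = refl
toSeries-*ₛ (x ∷ []) s (suc n) =
  trans (cong (_+_ (x * s (suc n))) (*ₛ-zeroˡ s n)) (ℤ.+-identityʳ (x * s (suc n)))
toSeries-*ₛ (x ∷ y ∷ xs) s zero = refl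
toSeries-*ₛ (x ∷ y ∷ xs) s (suc n) = cong (_+_ (x * s (suc n))) (toSeries-*ₛ (y ∷ xs) s n)

◃-cong : ∀ xs {s t} → s ≗ t → xs ◃ s ≗ xs ◃ t
◃-cong [] s≗t n = refl
◃-cong (x ∷ []) s≗t n = cong (x *_) (s≗t n)
◃-cong (x ∷ y ∷ xs) s≗t zero = cong (x *_) (s≗t 0)
◃-cong (x ∷ y ∷ xs) s≗t (suc n) = cong₂ _+_ (cong (x *_) (s≗t (suc n))) (◃-cong (y ∷ xs) s≗t n)

prefix : ℕ → Series → List ℤ
prefix zero s = []
prefix (suc d) s = s 0 ∷ prefix d (s ∘ suc)

toSeries-prefix : ∀ d s → (∀ k → s (d ℕ.+ k) ≡ + 0) → toSeries (prefix d s) ≗ s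
toSeries-prefix zero s s≡0 n = sym (s≡0 n)
toSeries-prefix (suc d) s s≡0 zero = refl
toSeries-prefix (suc d) s s≡0 (suc n) = toSeries-prefix d (s ∘ suc) s≡0 n

annihilated⇒rational : ∀ xs s d → (∀ k → (xs ◃ s) (d ℕ.+ k) ≡ + 0) →
  toSeries xs *ₛ s ≗ toSeries (prefix d (xs ◃ s))
annihilated⇒rational xs s d annihilated n =
  trans (toSeries-*ₛ xs s n) (sym (toSeries-prefix d (xs ◃ s) annihilated n))

-- Third-order linear recurrences

record Recurrence₃ (α β γ : ℤ) (t : Series) : Set where
  constructor recurrence₃
  field step : ∀ n → t (3 ℕ.+ n) ≡ α * t (2 ℕ.+ n) + β * t (1 ℕ.+ n) + γ * t n

recurrence₃-+ₛ : ∀ {α β γ} t u →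
  Recurrence₃ α β γ t → Recurrence₃ α β γ u → Recurrence₃ α β γ (t +ₛ u)
recurrence₃-+ₛ {α} {β} {γ} t u (recurrence₃ rec-t) (recurrence₃ rec-u) = recurrence₃ λ n →
  trans (cong₂ _+_ (rec-t n) (rec-u n))
        (linear α β γ (t (2 ℕ.+ n)) (t (1 ℕ.+ n)) (t n) (u (2 ℕ.+ n)) (u (1 ℕ.+ n)) (u n))
  where
  linear : ∀ α β γ x y z x′ y′ z′ →
    (α * x + β * y + γ * z) + (α * x′ + β * y′ + γ * z′) ≡ α * (x + x′) + β * (y + y′) + γ * (z + z′)
  linear = solve-∀

recurrence₃-scale : ∀ {α β γ} κ t → Recurrence₃ α β γ t → Recurrence₃ α β γ (λ n → κ * t n)
recurrence₃-scale {α} {β} {γ} κ t (recurrence₃ rec-t) = recurrence₃ λ n →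
  trans (cong (κ *_) (rec-t n)) (linear κ α β γ (t (2 ℕ.+ n)) (t (1 ℕ.+ n)) (t n))
  where
  linear : ∀ κ α β γ x y z → κ * (α * x + β * y + γ * z) ≡ α * (κ * x) + β * (κ * y) + γ * (κ * z)
  linear = solve-∀

tribonacci-recurrence : ∀ j → Recurrence₃ (+ 1) (+ 1) (+ 1) (λ m → + T (m ℕ.+ j))
tribonacci-recurrence j = recurrence₃ λ n →
  let x = T (2 ℕ.+ n ℕ.+ j); y = T (1 ℕ.+ n ℕ.+ j); z = T (n ℕ.+ j) in
  trans (ℤ.pos-+ (x ℕ.+ y) z) (trans (cong (_+ + z) (ℤ.pos-+ x y)) (unit (+ x) (+ y) (+ z)))
  where
  unit : ∀ x y z → x + y + z ≡ + 1 * x + + 1 * y + + 1 * z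
  unit = solve-∀

narayana-recurrence : Recurrence₃ (+ 1) (+ 0) (+ 1) (λ m → + c m)
narayana-recurrence = recurrence₃ λ n →
  trans (ℤ.pos-+ (c (2 ℕ.+ n)) (c n)) (unit (+ c (2 ℕ.+ n)) (+ c (1 ℕ.+ n)) (+ c n))
  where
  unit : ∀ x y z → x + z ≡ + 1 * x + + 0 * y + + 1 * z
  unit = solve-∀

padovan-recurrence : Recurrence₃ (+ 0) (+ 1) (+ 1) (λ m → + p m)
padovan-recurrence = recurrence₃ λ n →
  trans (ℤ.pos-+ (p (1 ℕ.+ n)) (p n)) (unit (+ p (2 ℕ.+ n)) (+ p (1 ℕ.+ n)) (+ p n))
  where
  unit : ∀ x y z → y + z ≡ + 0 * x + + 1 * y + + 1 * z
  unit = solve-∀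

tribonacciPoly narayanaPoly tribonacciNarayanaPoly : List ℤ
tribonacciPoly = + 1 ∷ - + 1 ∷ - + 1 ∷ - + 1 ∷ []
narayanaPoly = + 1 ∷ - + 1 ∷ + 0 ∷ - + 1 ∷ []
tribonacciNarayanaPoly = tribonacciPoly *ₚ narayanaPoly

-- The reciprocals of ∏_{i ≤ j} (x − ρᵢρⱼ), ρ running over the roots of x³ − x² − x − 1
-- and of x³ − x − 1 respectively.
tribonacciSquaresPoly padovanSquaresPoly : List ℤ
tribonacciSquaresPoly = + 1 ∷ - + 2 ∷ - + 3 ∷ - + 6 ∷ + 1 ∷ + 0 ∷ + 1 ∷ []
padovanSquaresPoly = + 1 ∷ - + 1 ∷ - + 1 ∷ - + 1 ∷ + 1 ∷ - + 1 ∷ + 1 ∷ []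

-- Stated in the shape ◃ unfolds to, so that the annihilation lemmas are direct instances.
tribonacci-squares-identity : ∀ t₀ t₁ t₂ t₃ t₄ t₅ t₆ →
  t₃ ≡ + 1 * t₂ + + 1 * t₁ + + 1 * t₀ → t₄ ≡ + 1 * t₃ + + 1 * t₂ + + 1 * t₁ →
  t₅ ≡ + 1 * t₄ + + 1 * t₃ + + 1 * t₂ → t₆ ≡ + 1 * t₅ + + 1 * t₄ + + 1 * t₃ →
  + 1 * (t₆ * t₆) + (- + 2 * (t₅ * t₅) + (- + 3 * (t₄ * t₄) + (- + 6 * (t₃ * t₃)
    + (+ 1 * (t₂ * t₂) + (+ 0 * (t₁ * t₁) + + 1 * (t₀ * t₀)))))) ≡ + 0
tribonacci-squares-identity t₀ t₁ t₂ _ _ _ _ refl refl refl refl = solve (t₀ ∷ t₁ ∷ t₂ ∷ [])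

tribonacci-squares-annihilated : ∀ t → Recurrence₃ (+ 1) (+ 1) (+ 1) t →
  ∀ n → (tribonacciSquaresPoly ◃ (λ m → t m * t m)) (6 ℕ.+ n) ≡ + 0
tribonacci-squares-annihilated t (recurrence₃ rec) n =
  tribonacci-squares-identity (t n) (t (1 ℕ.+ n)) (t (2 ℕ.+ n)) _ _ _ _
    (rec n) (rec (1 ℕ.+ n)) (rec (2 ℕ.+ n)) (rec (3 ℕ.+ n))

padovan-squares-identity : ∀ t₀ t₁ t₂ t₃ t₄ t₅ t₆ →
  t₃ ≡ + 0 * t₂ + + 1 * t₁ + + 1 * t₀ → t₄ ≡ + 0 * t₃ + + 1 * t₂ + + 1 * t₁ →
  t₅ ≡ + 0 * t₄ + + 1 * t₃ + + 1 * t₂ → t₆ ≡ + 0 * t₅ + + 1 * t₄ + + 1 * t₃ →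
  + 1 * (t₆ * t₆) + (- + 1 * (t₅ * t₅) + (- + 1 * (t₄ * t₄) + (- + 1 * (t₃ * t₃)
    + (+ 1 * (t₂ * t₂) + (- + 1 * (t₁ * t₁) + + 1 * (t₀ * t₀)))))) ≡ + 0
padovan-squares-identity t₀ t₁ t₂ _ _ _ _ refl refl refl refl = solve (t₀ ∷ t₁ ∷ t₂ ∷ [])

padovan-squares-annihilated : ∀ t → Recurrence₃ (+ 0) (+ 1) (+ 1) t →
  ∀ n → (padovanSquaresPoly ◃ (λ m → t m * t m)) (6 ℕ.+ n) ≡ + 0
padovan-squares-annihilated t (recurrence₃ rec) n =
  padovan-squares-identity (t n) (t (1 ℕ.+ n)) (t (2 ℕ.+ n)) _ _ _ _
    (rec n) (rec (1 ℕ.+ n)) (rec (2 ℕ.+ n)) (rec (3 ℕ.+ n))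

tribonacci+narayana-identity : ∀ t₀ t₁ t₂ t₃ t₄ t₅ t₆ u₀ u₁ u₂ u₃ u₄ u₅ u₆ →
  t₃ ≡ + 1 * t₂ + + 1 * t₁ + + 1 * t₀ → t₄ ≡ + 1 * t₃ + + 1 * t₂ + + 1 * t₁ →
  t₅ ≡ + 1 * t₄ + + 1 * t₃ + + 1 * t₂ → t₆ ≡ + 1 * t₅ + + 1 * t₄ + + 1 * t₃ →
  u₃ ≡ + 1 * u₂ + + 0 * u₁ + + 1 * u₀ → u₄ ≡ + 1 * u₃ + + 0 * u₂ + + 1 * u₁ →
  u₅ ≡ + 1 * u₄ + + 0 * u₃ + + 1 * u₂ → u₆ ≡ + 1 * u₅ + + 0 * u₄ + + 1 * u₃ →
  + 1 * (t₆ + u₆) + (- + 2 * (t₅ + u₅) + (+ 0 * (t₄ + u₄) + (- + 1 * (t₃ + u₃)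
    + (+ 2 * (t₂ + u₂) + (+ 1 * (t₁ + u₁) + + 1 * (t₀ + u₀)))))) ≡ + 0
tribonacci+narayana-identity t₀ t₁ t₂ _ _ _ _ u₀ u₁ u₂ _ _ _ _ refl refl refl refl refl refl refl refl =
  solve (t₀ ∷ t₁ ∷ t₂ ∷ u₀ ∷ u₁ ∷ u₂ ∷ [])

tribonacci+narayana-annihilated : ∀ t u →
  Recurrence₃ (+ 1) (+ 1) (+ 1) t → Recurrence₃ (+ 1) (+ 0) (+ 1) u →
  ∀ n → (tribonacciNarayanaPoly ◃ (t +ₛ u)) (6 ℕ.+ n) ≡ + 0
tribonacci+narayana-annihilated t u (recurrence₃ rec-t) (recurrence₃ rec-u) n =
  tribonacci+narayana-identity
    (t n) (t (1 ℕ.+ n)) (t (2 ℕ.+ n)) _ _ _ _ (u n) (u (1 ℕ.+ n)) (u (2 ℕ.+ n)) _ _ _ _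
    (rec-t n) (rec-t (1 ℕ.+ n)) (rec-t (2 ℕ.+ n)) (rec-t (3 ℕ.+ n))
    (rec-u n) (rec-u (1 ℕ.+ n)) (rec-u (2 ℕ.+ n)) (rec-u (3 ℕ.+ n))

tribonacci² padovan² weight : Series
tribonacci² m = + T (m ℕ.+ 2) * + T (m ℕ.+ 2)
padovan² m = + p m * + p m
weight l = (+ 4) * (+ T l + + T (l ∸ 1)) + δ l 1 - (+ 2) * δ l 2 - (+ 2) * (+ cℤ (+ l - + 5))

tribonacciPart narayanaPart : Series
tribonacciPart k = + 4 * (+ T (k ℕ.+ 5) + + T (k ℕ.+ 4))
narayanaPart k = - + 2 * + c k

tribonacciPart-recurrence : Recurrence₃ (+ 1) (+ 1) (+ 1) tribonacciPart
tribonacciPart-recurrence =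
  recurrence₃-scale (+ 4) (λ k → + T (k ℕ.+ 5) + + T (k ℕ.+ 4))
    (recurrence₃-+ₛ (λ k → + T (k ℕ.+ 5)) (λ k → + T (k ℕ.+ 4))
      (tribonacci-recurrence 5) (tribonacci-recurrence 4))

narayanaPart-recurrence : Recurrence₃ (+ 1) (+ 0) (+ 1) narayanaPart
narayanaPart-recurrence = recurrence₃-scale (- + 2) (λ k → + c k) narayana-recurrence

-- From l = 5 on, both deltas are + 0 and cℤ (+ l - + 5) is c (l ∸ 5), all definitionally.
weight-tail : ∀ m → weight (5 ℕ.+ m) ≡ (tribonacciPart +ₛ narayanaPart) m
weight-tail m =
  trans (cong (λ j → + 4 * (+ T j + + T (4 ℕ.+ m)) + + 0 - + 2 * + 0 - + 2 * + c m) (ℕₚ.+-comm 5 m))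
        (trans (cong (λ j → + 4 * (+ T (m ℕ.+ 5) + + T j) + + 0 - + 2 * + 0 - + 2 * + c m) (ℕₚ.+-comm 4 m))
               (simplify (+ 4 * (+ T (m ℕ.+ 5) + + T (m ℕ.+ 4))) (+ c m)))
  where
  simplify : ∀ x y → x + + 0 - + 2 * + 0 - + 2 * y ≡ x + - + 2 * y
  simplify = solve-∀

tribonacci²-rational :
  toSeries tribonacciSquaresPoly *ₛ tribonacci² ≗ toSeries (prefix 6 (tribonacciSquaresPoly ◃ tribonacci²))
tribonacci²-rational = annihilated⇒rational tribonacciSquaresPoly tribonacci² 6
  (tribonacci-squares-annihilated (λ m → + T (m ℕ.+ 2)) (tribonacci-recurrence 2))

padovan²-rational :
  toSeries padovanSquaresPoly *ₛ padovan² ≗ toSeries (prefix 6 (padovanSquaresPoly ◃ padovan²))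
padovan²-rational = annihilated⇒rational padovanSquaresPoly padovan² 6
  (padovan-squares-annihilated (λ m → + p m) padovan-recurrence)

weight-rational :
  toSeries tribonacciNarayanaPoly *ₛ weight ≗ toSeries (prefix 11 (tribonacciNarayanaPoly ◃ weight))
weight-rational = annihilated⇒rational tribonacciNarayanaPoly weight 11 λ k →
  trans (◃-cong tribonacciNarayanaPoly weight-tail (6 ℕ.+ k))
        (tribonacci+narayana-annihilated tribonacciPart narayanaPart
          tribonacciPart-recurrence narayanaPart-recurrence k)

generating-function-equation : tribonacci² ≗ padovan² +ₛ (weight *ₛ tribonacci²) *ₛ padovan²
generating-function-equation =
  *ₛ-fraction-equation refl tribonacci²-rational padovan²-rational weight-rational numerators
  where
  aₚ qₚ fₚ nₐ n_q n_f : List ℤ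
  aₚ = tribonacciSquaresPoly
  qₚ = padovanSquaresPoly
  fₚ = tribonacciNarayanaPoly
  nₐ = prefix 6 (aₚ ◃ tribonacci²)
  n_q = prefix 6 (qₚ ◃ padovan²)
  n_f = prefix 11 (fₚ ◃ weight)

  toSeries-*ₚ-*ₚ : ∀ xs ys zs → toSeries ((xs *ₚ ys) *ₚ zs) ≗ (toSeries xs *ₛ toSeries ys) *ₛ toSeries zs
  toSeries-*ₚ-*ₚ xs ys zs n =
    trans (toSeries-*ₚ (xs *ₚ ys) zs n) (*ₛ-cong (toSeries-*ₚ xs ys) (λ _ → refl) n)

  numerators : (toSeries qₚ *ₛ toSeries fₚ) *ₛ toSeries nₐ
             ≗ (toSeries aₚ *ₛ toSeries fₚ) *ₛ toSeries n_q +ₛ (toSeries n_f *ₛ toSeries nₐ) *ₛ toSeries n_q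
  numerators n = begin
    ((toSeries qₚ *ₛ toSeries fₚ) *ₛ toSeries nₐ) n
      ≡⟨ toSeries-*ₚ-*ₚ qₚ fₚ nₐ n ⟨
    toSeries ((qₚ *ₚ fₚ) *ₚ nₐ) n
      ≡⟨ normalise⇒toSeries-≗ ((qₚ *ₚ fₚ) *ₚ nₐ) ((aₚ *ₚ fₚ) *ₚ n_q +ₚ (n_f *ₚ nₐ) *ₚ n_q)
                              refl n ⟩
    toSeries ((aₚ *ₚ fₚ) *ₚ n_q +ₚ (n_f *ₚ nₐ) *ₚ n_q) n
      ≡⟨ toSeries-+ₚ ((aₚ *ₚ fₚ) *ₚ n_q) ((n_f *ₚ nₐ) *ₚ n_q) n ⟩
    toSeries ((aₚ *ₚ fₚ) *ₚ n_q) n + toSeries ((n_f *ₚ nₐ) *ₚ n_q) n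
      ≡⟨ cong₂ _+_ (toSeries-*ₚ-*ₚ aₚ fₚ n_q n) (toSeries-*ₚ-*ₚ n_f nₐ n_q n) ⟩
    ((toSeries aₚ *ₛ toSeries fₚ) *ₛ toSeries n_q +ₛ (toSeries n_f *ₛ toSeries nₐ) *ₛ toSeries n_q) n ∎
    where open ≡-Reasoning

mainTheorem13 : (n : ℕ) →
    (+ T (n Data.Nat.+ 2)) * (+ T (n Data.Nat.+ 2)) ≡
      (+ p n) * (+ p n)
      + Σ1 n (λ k → Σ1 k (λ l →
          ((+ 4) * (+ T l + + T (l ∸ 1)) + δ l 1 - (+ 2) * δ l 2 - (+ 2) * (+ cℤ (+ l - + 5)))
          * ((+ T (k ∸ l Data.Nat.+ 2)) * (+ T (k ∸ l Data.Nat.+ 2)))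
          * ((+ p (n ∸ k)) * (+ p (n ∸ k)))))
mainTheorem13 n =
  trans (generating-function-equation n)
        (cong (_+_ (padovan² n)) (f₀≡0⇒*ₛ-as-double-Σ1 weight tribonacci² padovan² refl n))
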